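{- Every graph of rankwidth $k$ has distance $2$VC-dimension at most $3\cdot 2^{k+1}+2$.
   Context: All graphs are finite and simple. For a graph $G=(V,E)$, $d_G(x,y)$ is the shortest-path distance ($+\infty$ if none) and $B_G(x,k)=\{y: d_G(x,y)\le k\}$. The $B$-hypergraph of $G$ has vertex set $V$ and hyperedges all balls $B_G(v,k)$, $v\in V$, $k\ge 0$ integer. A set $X$ of vertices is $2$-shattered by a hypergraph if for every $X'\subseteq X$ with $|X'|=2$ there is a hyperedge $e$ with $e\cap X=X'$; the $2$VC-dimension is the maximum size of a $2$-shattered set. The distance $2$VC-dimension of $G$ is the maximum over induced subgraphs $G'$ of $G$ of the $2$VC-dimension of the $B$-hypergraph of $G'$. Rankwidth: for a partition $(V_1,V_2)$ of $V$, the cutrank $cr(V_1,V_2)$ is the rank over $\mathbb{F}_2$ of the $|V_1|\times|V_2|$ matrix with entry $1$ at $(x_1,x_2)$ iff $x_1x_2\in E$. A ternary tree is a tree whose nodes have degree $1$ or $3$. A tree-representation of $G$ is a pair $(T,f)$ with $T$ a ternary tree with $|V|$ leaves and $f$ a bijection from $V$ to the leaves of $T$; each edge $e$ of $T$ induces a partition $(V_1^e,V_2^e)$ of $V$ via the two components of $T-e$. The rankwidth of $G$ is $\min_{(T,f)}\max_{e\in E(T)} cr(V_1^e,V_2^e)$. -}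

module Defs where

open import Data.Nat using (ℕ; zero; suc; _+_; _*_; _^_; _≤_; _<_)
open import Data.Bool using (Bool; true; false; _∧_; _∨_; not; _xor_; if_then_else_)
open import Data.Fin using (Fin; zero; suc; inject₁; fromℕ; _≟_)
open import Data.Fin.Subset using (Subset; _∈_; ∣_∣)
open import Data.Product using (Σ; ∃; ∃-syntax; _×_; _,_)
open import Data.Sum using (_⊎_)
open import Relation.Nullary using (¬_)
open import Relation.Nullary.Decidable using (⌊_⌋)
open import Relation.Binary.PropositionalEquality using (_≡_; _≢_)
open import Function.Definitions using (Injective)

record Graph (n : ℕ) : Set where
  field
    adj    : Fin n → Fin n → Bool
    sym    : ∀ x y → adj x y ≡ adj y x
    irrefl : ∀ x → adj x x ≡ false
open Graph public

data Walk {t : ℕ} (E : Fin t → Fin t → Bool) : Fin t → Fin t → ℕ → Set where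
  here : ∀ {x} → Walk E x x 0
  step : ∀ {x y z ℓ} → E x y ≡ true → Walk E y z ℓ → Walk E x z (suc ℓ)

Reach : {t : ℕ} → (Fin t → Fin t → Bool) → Fin t → Fin t → Set
Reach E x y = ∃[ ℓ ] Walk E x y ℓ

InBall : {n : ℕ} → Graph n → Fin n → ℕ → Fin n → Set
InBall G v k y = ∃[ ℓ ] (ℓ ≤ k × Walk (adj G) v y ℓ)

-- Induced subgraphs: the subgraph induced on the image of an injective
-- map f : Fin m → Fin n.

induced : {n m : ℕ} → Graph n → (Fin m → Fin n) → Graph m
induced G f = record
  { adj    = λ i j → adj G (f i) (f j)
  ; sym    = λ i j → sym G (f i) (f j)
  ; irrefl = λ i → irrefl G (f i)
  }

TwoShatteredB : {m : ℕ} → Graph m → Subset m → Set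
TwoShatteredB H X =
  ∀ a b → a ∈ X → b ∈ X → a ≢ b →
  ∃[ v ] ∃[ k ] (InBall H v k a × InBall H v k b ×
                 (∀ x → x ∈ X → InBall H v k x → x ≡ a ⊎ x ≡ b))

Distance2VCDimLe : {n : ℕ} → Graph n → ℕ → Set
Distance2VCDimLe {n} G D =
  ∀ (m : ℕ) (f : Fin m → Fin n) → Injective _≡_ _≡_ f →
  ∀ (X : Subset m) → TwoShatteredB (induced G f) X → ∣ X ∣ ≤ D

⊕-sum : {j : ℕ} → (Fin j → Bool) → Bool
⊕-sum {zero}  b = false
⊕-sum {suc j} b = b zero xor ⊕-sum (λ i → b (suc i))

combo : {n j : ℕ} → Graph n → (Fin j → Bool) → (Fin j → Fin n) → Fin n → Bool
combo G c r y = ⊕-sum (λ i → c i ∧ adj G (r i) y)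

-- The rows r are linearly independent in the V₁ × V₂ matrix, where
-- V₁ = S and V₂ = complement of S.
RowsIndependent : {n j : ℕ} → Graph n → (Fin n → Set) → (Fin j → Fin n) → Set
RowsIndependent {n} {j} G S r =
  ∀ (c : Fin j → Bool) → (∃[ i ] c i ≡ true) →
  ∃[ y ] (¬ S y × combo G c r y ≡ true)

-- cr(S, V∖S) ≤ k : any k+1 rows (indexed by vertices of S) are dependent,
-- i.e. the maximum number of linearly independent rows is ≤ k.
CutRankLe : {n : ℕ} → Graph n → (Fin n → Set) → ℕ → Set
CutRankLe {n} G S k =
  ∀ (r : Fin (suc k) → Fin n) → (∀ i → S (r i)) → ¬ RowsIndependent G S r

count : {t : ℕ} → (Fin t → Bool) → ℕ
count {zero}  b = 0
count {suc t} b = (if b zero then 1 else 0) + count (λ i → b (suc i))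

deg : {t : ℕ} → Graph t → Fin t → ℕ
deg T u = count (adj T u)

IsCycle : {t j : ℕ} → Graph t → (Fin (3 + j) → Fin t) → Set
IsCycle {t} {j} T c =
  Injective _≡_ _≡_ c ×
  (∀ (i : Fin (2 + j)) → adj T (c (inject₁ i)) (c (suc i)) ≡ true) ×
  adj T (c (fromℕ (2 + j))) (c zero) ≡ true

record TernaryTree : Set where
  field
    size      : ℕ
    tree      : Graph size
    connected : ∀ u v → Reach (adj tree) u v
    acyclic   : ∀ (j : ℕ) (c : Fin (3 + j) → Fin size) → ¬ IsCycle tree c
    degree13  : ∀ u → deg tree u ≡ 1 ⊎ deg tree u ≡ 3
open TernaryTree public

record TreeRep (n : ℕ) : Set where
  field
    T        : TernaryTree
    f        : Fin n → Fin (size T)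
    f-inj    : Injective _≡_ _≡_ f
    f-leaf   : ∀ x → deg (tree T) (f x) ≡ 1
    f-onto   : ∀ u → deg (tree T) u ≡ 1 → ∃[ x ] f x ≡ u
open TreeRep public

removeEdge : {t : ℕ} → Graph t → Fin t → Fin t → Fin t → Fin t → Bool
removeEdge T u w a b =
  adj T a b ∧ not ((⌊ a ≟ u ⌋ ∧ ⌊ b ≟ w ⌋) ∨ (⌊ a ≟ w ⌋ ∧ ⌊ b ≟ u ⌋))

-- V₁ for the edge uw of T: vertices x whose leaf f x lies in the
-- component of T − uw containing u (V₂ is the complement).
EdgeSide : {n : ℕ} → (R : TreeRep n) → Fin (size (T R)) → Fin (size (T R)) → Fin n → Set
EdgeSide R u w x = Reach (removeEdge (tree (T R)) u w) u (f R x)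

RepWidthLe : {n : ℕ} → Graph n → TreeRep n → ℕ → Set
RepWidthLe G R k =
  ∀ u w → adj (tree (T R)) u w ≡ true → CutRankLe G (EdgeSide R u w) k

RankwidthLe : {n : ℕ} → Graph n → ℕ → Set
RankwidthLe {n} G k = ∃[ R ] RepWidthLe {n} G R k

HasRankwidth : {n : ℕ} → Graph n → ℕ → Set
HasRankwidth G k = RankwidthLe G k × (∀ j → j < k → ¬ RankwidthLe G j)

module Submission where

-- Fix a tree-representation (T, f) of G of width k, an induced subgraph
-- H = G[g] and a set X that is 2-shattered by the balls of H; put K = 2^k + 1.
-- We show |X| < 3K, which implies the stated bound.
-- * Cut lemma (CutCrossing): cut the vertices of H by an edge of T.  No K
--   balls B(vᵢ, rᵢ) centred on one side can each contain their own target yᵢ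
--   on the other side but no other yⱼ.  A walk vᵢ → yᵢ leaves the centres'
--   side along an edge pᵢqᵢ; the neighbourhoods of the qᵢ across the cut are
--   pairwise distinct (equal ones would put some yⱼ into ball i), and among
--   more than 2^k distinct vectors of F₂^m some k + 1 are independent,
--   contradicting cut-rank ≤ k.
-- * Balanced edges (BalancedEdge): no edge of T has K elements of X on each
--   side, by the cut lemma applied to balls meeting X in {aᵢ, bⱼ}.
-- * Descent: moving from an edge into its side holding K elements of X, one
--   reaches a leaf (whose side holds ≤ 1 element) or a node whose three
--   sides all hold fewer than K elements, contradicting |X| ≥ 3K.
-- The classical steps (which side of an edge a node is on, case splits,
-- choosing independent vectors) run in the double-negation monad; this
-- suffices because the conclusion |X| ≤ D is decidable.

open import Defs hiding (sym)
open import Data.Bool using (Bool; true; false; _∧_; not; _xor_; if_then_else_)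
open import Data.Bool.Properties
  using (∧-conicalˡ; ∧-conicalʳ; ∧-zeroʳ) renaming (_≟_ to _≟ᵇ_)
open import Data.Empty using (⊥; ⊥-elim)
open import Data.Fin using (Fin; zero; suc; inject₁; fromℕ; _≟_; funToFin; finToFun)
open import Data.Fin.Properties
  using (<⇒notInjective; finToFun-funToFin; any?) renaming (suc-injective to fsuc-injective)
open import Data.Fin.Subset using (Subset; _∈_; ∣_∣)
open import Data.Nat using (ℕ; zero; suc; _+_; _*_; _^_; _≤_; _<_; z≤n; s≤s; _≤?_)
open import Data.Nat.Properties
  using (+-commutativeSemigroup; +-comm; +-assoc; +-identityʳ; +-suc; *-suc; +-mono-≤; +-mono-<;
         +-monoˡ-≤; +-monoʳ-≤; *-monoʳ-≤; ^-monoʳ-≤; m≤m+n; m≤n+m; m≤n⇒m≤1+n; m^n>0; suc-injective;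
         ≤-refl; ≤-trans; ≤-reflexive; ≤-antisym; ≤-total; ≤-pred; ≤-<-trans; <⇒≱; ≰⇒>; 1+n≰n;
         module ≤-Reasoning)
open import Algebra.Properties.CommutativeSemigroup +-commutativeSemigroup using (interchange)
open import Data.Product using (Σ; ∃; ∃-syntax; _×_; _,_; proj₁; proj₂)
import Data.Product as Product
open import Data.Sum using (_⊎_; inj₁; inj₂)
import Data.Sum as Sum
open import Data.Unit using (⊤; tt)
open import Data.Vec using (lookup; []; _∷_)
open import Data.Vec.Properties using (lookup⇒[]=)
open import Function using (_∘_)
open import Function.Bundles using (mk⇔)
open import Function.Definitions using (Injective)
open import Relation.Binary.PropositionalEquality
open import Relation.Nullary using (¬_; Dec; yes; no; does; _×-dec_; _⊎-dec_)
open import Relation.Nullary.Decidable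
  using (dec-true; dec-false; isYes≗does; does-⇔; decidable-stable; ¬¬-excluded-middle)

¬¬-finite-choice : ∀ {K} {A : Fin K → Set} → (∀ i → ¬ ¬ A i) → ¬ ¬ (∀ i → A i)
¬¬-finite-choice {zero}  h k = k (λ ())
¬¬-finite-choice {suc K} h k =
  h zero λ a₀ → ¬¬-finite-choice (λ i → h (suc i)) λ as →
    k λ { zero → a₀ ; (suc i) → as i }

¬¬-decide-all : ∀ {K} (P : Fin K → Set) → ¬ ¬ (∀ i → Dec (P i))
¬¬-decide-all P = ¬¬-finite-choice (λ i → ¬¬-excluded-middle)

true≢false : true ≢ false
true≢false ()

does-true : ∀ {P : Set} (p? : Dec P) → does p? ≡ true → P
does-true (yes p) _ = p

ι : Bool → ℕ
ι b = if b then 1 else 0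

count-cong : ∀ {t} {b c : Fin t → Bool} → (∀ i → b i ≡ c i) → count b ≡ count c
count-cong {zero}  h = refl
count-cong {suc t} h = cong₂ _+_ (cong ι (h zero)) (count-cong (λ i → h (suc i)))

count-allfalse : ∀ {t} {b : Fin t → Bool} → (∀ i → b i ≡ false) → count b ≡ 0
count-allfalse {zero}  h = refl
count-allfalse {suc t} h rewrite h zero = count-allfalse (λ i → h (suc i))

count-mono : ∀ {t} {b c : Fin t → Bool} → (∀ i → b i ≡ true → c i ≡ true) → count b ≤ count c
count-mono {zero}  h = z≤n
count-mono {suc t} h = +-mono-≤ (ι-mono (h zero)) (count-mono (λ i → h (suc i)))
  where
  ι-mono : ∀ {x y} → (x ≡ true → y ≡ true) → ι x ≤ ι y
  ι-mono {false} _ = z≤n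
  ι-mono {true}  h rewrite h refl = ≤-refl

count-union : ∀ {t} {b c d : Fin t → Bool} → (∀ i → b i ≡ true → c i ≡ true ⊎ d i ≡ true) →
  count b ≤ count c + count d
count-union {zero} h = z≤n
count-union {suc t} {b} {c} {d} h =
  ≤-trans (+-mono-≤ (ι-union (h zero)) (count-union (λ i → h (suc i))))
          (≤-reflexive (interchange (ι (c zero)) (ι (d zero)) _ _))
  where
  ι-union : ∀ {x y z} → (x ≡ true → y ≡ true ⊎ z ≡ true) → ι x ≤ ι y + ι z
  ι-union {false} _ = z≤n
  ι-union {true} {y} h with h refl
  ... | inj₁ refl = s≤s z≤n
  ... | inj₂ refl = ≤-trans (s≤s z≤n) (≤-reflexive (+-comm 1 (ι y)))

count-member : ∀ {t} {b : Fin t → Bool} i → b i ≡ true → 1 ≤ count b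
count-member {suc t} zero    e rewrite e = s≤s z≤n
count-member {suc t} {b} (suc i) e = ≤-trans (count-member i e) (m≤n+m _ (ι (b zero)))

count-zero : ∀ {t} {b : Fin t → Bool} → count b ≡ 0 → ∀ i → b i ≡ false
count-zero {b = b} e i with b i in bi
... | false = refl
... | true with () ← subst (1 ≤_) e (count-member i bi)

count-witness : ∀ {t} {b : Fin t → Bool} → 1 ≤ count b → ∃[ i ] b i ≡ true
count-witness {suc t} {b} pos with b zero in b₀
... | true  = zero , b₀
... | false with count-witness {b = λ i → b (suc i)} pos
... | i , e = suc i , e

count-≤1 : ∀ {t} {b : Fin t → Bool} → (∀ i j → b i ≡ true → b j ≡ true → i ≡ j) → count b ≤ 1
count-≤1 {b = b} unique with any? (λ i → b i ≟ᵇ true)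
... | yes (w , bw) = ≤-trans (count-mono only-w) (≤-reflexive (count-singleton w))
  where
  only-w : ∀ i → b i ≡ true → does (i ≟ w) ≡ true
  only-w i bi = dec-true (i ≟ w) (unique i w bi bw)
  count-singleton : ∀ {t} (w : Fin t) → count (λ i → does (i ≟ w)) ≡ 1
  count-singleton {suc t} zero = cong suc (count-allfalse {t} (λ _ → refl))
  count-singleton {suc t} (suc w) = count-singleton w
... | no none = ≤-trans (≤-reflexive (count-allfalse absent)) z≤n
  where
  absent : ∀ i → b i ≡ false
  absent i with b i in bi
  ... | false = refl
  ... | true  = ⊥-elim (none (i , bi))

count-split : ∀ {t} (b c : Fin t → Bool) →
  count (λ i → b i ∧ c i) + count (λ i → b i ∧ not (c i)) ≡ count b
count-split {zero}  b c = refl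
count-split {suc t} b c =
  trans (interchange (ι (b zero ∧ c zero)) _ (ι (b zero ∧ not (c zero))) _)
        (cong₂ _+_ (ι-split (b zero) (c zero)) (count-split (λ i → b (suc i)) (λ i → c (suc i))))
  where
  ι-split : ∀ x y → ι (x ∧ y) + ι (x ∧ not y) ≡ ι x
  ι-split false y     = refl
  ι-split true  false = refl
  ι-split true  true  = refl

count-strict : ∀ {t} {b c : Fin t → Bool} → (∀ i → b i ≡ true → c i ≡ true) →
  ∀ j → b j ≡ false → c j ≡ true → count b < count c
count-strict {b = b} {c} sub j bj cj =
  ≤-trans (≤-trans (≤-reflexive (+-comm 1 (count b))) (+-mono-≤ inside outside))
          (≤-reflexive (count-split c b))
  where
  inside : count b ≤ count (λ i → c i ∧ b i)
  inside = count-mono λ i bi → subst (λ z → z ∧ b i ≡ true) (sym (sub i bi)) bi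
  outside : 1 ≤ count (λ i → c i ∧ not (b i))
  outside = count-member j (subst₂ (λ x y → x ∧ not y ≡ true) (sym cj) (sym bj) refl)

infixl 20 _without_
_without_ : ∀ {t} → (Fin t → Bool) → Fin t → Fin t → Bool
(b without w) i = b i ∧ not (does (i ≟ w))

member-split : ∀ {t} (b : Fin t → Bool) {v w} → b v ≡ true → v ≡ w ⊎ (b without w) v ≡ true
member-split b {v} {w} bv with v ≟ w
... | yes v≡w = inj₁ v≡w
... | no  _   rewrite bv = inj₂ refl

without-elim : ∀ {t} (b : Fin t → Bool) {v w} → (b without w) v ≡ true → b v ≡ true × v ≢ w
without-elim b {v} {w} e = ∧-conicalˡ _ _ e , λ v≡w →
  true≢false (trans (sym e) (trans (cong (λ z → b v ∧ not z) (dec-true (v ≟ w) v≡w)) (∧-zeroʳ (b v))))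

count-remove : ∀ {t} {b : Fin t → Bool} w → b w ≡ true → count b ≡ suc (count (b without w))
count-remove {b = b} w bw =
  trans (sym (count-split b (λ i → does (i ≟ w)))) (cong (_+ count (b without w)) just-w)
  where
  at-w : ∀ i → b i ∧ does (i ≟ w) ≡ true → i ≡ w
  at-w i e = does-true (i ≟ w) (∧-conicalʳ (b i) _ e)
  just-w : count (λ i → b i ∧ does (i ≟ w)) ≡ 1
  just-w = ≤-antisym (count-≤1 λ i j ei ej → trans (at-w i ei) (sym (at-w j ej)))
                     (count-member w (subst₂ (λ x y → x ∧ y ≡ true) (sym bw) (sym (dec-true (w ≟ w) refl)) refl))

count-pick : ∀ {t} (b : Fin t → Bool) {c} → count b ≡ suc c →
  ∃[ w ] (b w ≡ true × count (b without w) ≡ c)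
count-pick b e with count-witness {b = b} (subst (1 ≤_) (sym e) (s≤s z≤n))
... | w , bw = w , bw , suc-injective (trans (sym (count-remove w bw)) e)

record Selection {t} (b : Fin t → Bool) (N : ℕ) : Set where
  field
    pick      : Fin N → Fin t
    injective : Injective _≡_ _≡_ pick
    chosen    : ∀ i → b (pick i) ≡ true

count-select : ∀ {t} (b : Fin t → Bool) N → N ≤ count b → Selection b N
count-select b zero _ = record { pick = λ () ; injective = λ {x} → λ { } ; chosen = λ () }
count-select {suc t} b (suc N) le with b zero in b₀
... | true = record { pick = pick′ ; injective = injective′ ; chosen = chosen′ }
  where
  open Selection (count-select (b ∘ suc) N (≤-pred le))
  pick′ : Fin (suc N) → Fin (suc t)
  pick′ zero    = zero
  pick′ (suc i) = suc (pick i)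
  injective′ : Injective _≡_ _≡_ pick′
  injective′ {zero}  {zero}  _ = refl
  injective′ {suc _} {suc _} e = cong suc (injective (fsuc-injective e))
  chosen′ : ∀ i → b (pick′ i) ≡ true
  chosen′ zero    = b₀
  chosen′ (suc i) = chosen i
... | false = record { pick = suc ∘ pick ; injective = injective ∘ fsuc-injective ; chosen = chosen }
  where open Selection (count-select (b ∘ suc) (suc N) le)

∣∣≡count : ∀ {m} (X : Subset m) → ∣ X ∣ ≡ count (lookup X)
∣∣≡count []          = refl
∣∣≡count (true ∷ X)  = cong suc (∣∣≡count X)
∣∣≡count (false ∷ X) = ∣∣≡count X

walk-map : ∀ {t} {E E′ : Fin t → Fin t → Bool} → (∀ a b → E a b ≡ true → E′ a b ≡ true) →
  ∀ {x y ℓ} → Walk E x y ℓ → Walk E′ x y ℓ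
walk-map h here       = here
walk-map h (step e W) = step (h _ _ e) (walk-map h W)

module _ {t : ℕ} {E : Fin t → Fin t → Bool} where

  append : ∀ {x y z ℓ ℓ′} → Walk E x y ℓ → Walk E y z ℓ′ → Walk E x z (ℓ + ℓ′)
  append here       W′ = W′
  append (step e W) W′ = step e (append W W′)

  reach-snoc : ∀ {x y z} → Reach E x y → E y z ≡ true → Reach E x z
  reach-snoc (_ , W) e = _ , append W (step e here)

  reverse : (∀ a b → E a b ≡ E b a) → ∀ {x y ℓ} → Walk E x y ℓ → Walk E y x ℓ
  reverse s here = here
  reverse s (step {x} {y} e W) =
    subst (Walk E _ x) (+-comm _ 1) (append (reverse s W) (step (trans (s y x) e) here))

  vertex : ∀ {x y ℓ} → Walk E x y ℓ → Fin (suc ℓ) → Fin t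
  vertex {x} W          zero    = x
  vertex     (step e W) (suc i) = vertex W i

  vertex-adj : ∀ {x y ℓ} (W : Walk E x y ℓ) (i : Fin ℓ) →
    E (vertex W (inject₁ i)) (vertex W (suc i)) ≡ true
  vertex-adj (step e W) zero    = e
  vertex-adj (step e W) (suc i) = vertex-adj W i

  vertex-last : ∀ {x y ℓ} (W : Walk E x y ℓ) → vertex W (fromℕ ℓ) ≡ y
  vertex-last here       = refl
  vertex-last (step e W) = vertex-last W

  Visits : ∀ {x y ℓ} → Fin t → Walk E x y ℓ → Set
  Visits z (here {x})     = z ≡ x
  Visits z (step {x} e W) = z ≡ x ⊎ Visits z W

  visits? : ∀ {x y ℓ} z (W : Walk E x y ℓ) → Dec (Visits z W)
  visits? z here       = z ≟ _
  visits? z (step e W) = (z ≟ _) ⊎-dec visits? z W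

  vertex-visits : ∀ {x y ℓ} (W : Walk E x y ℓ) i → Visits (vertex W i) W
  vertex-visits here       zero    = refl
  vertex-visits (step e W) zero    = inj₁ refl
  vertex-visits (step e W) (suc i) = inj₂ (vertex-visits W i)

  Simple : ∀ {x y ℓ} → Walk E x y ℓ → Set
  Simple here           = ⊤
  Simple (step {x} e W) = ¬ Visits x W × Simple W

  SimpleWalk : Fin t → Fin t → Set
  SimpleWalk x y = Σ ℕ λ ℓ → Σ (Walk E x y ℓ) Simple

  suffix : ∀ {x y ℓ} z (W : Walk E x y ℓ) → Visits z W → Simple W → SimpleWalk z y
  suffix z here              refl     s      = _ , here , tt
  suffix z (step e W)        (inj₁ refl) s   = _ , step e W , s
  suffix z (step e W)        (inj₂ v) (_ , s) = suffix z W v s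

  shortcut : ∀ {x y ℓ} → Walk E x y ℓ → SimpleWalk x y
  shortcut here = _ , here , tt
  shortcut (step {x} e W) with shortcut W
  ... | _ , W′ , s with visits? x W′
  ...   | yes v = suffix x W′ v s
  ...   | no ¬v = _ , step e W′ , ¬v , s

  simple-injective : ∀ {x y ℓ} (W : Walk E x y ℓ) → Simple W → Injective _≡_ _≡_ (vertex W)
  simple-injective here       s        {zero}  {zero}  _ = refl
  simple-injective (step _ W) s        {zero}  {zero}  _ = refl
  simple-injective (step _ W) (¬v , s) {zero}  {suc j} e =
    ⊥-elim (¬v (subst (λ z → Visits z W) (sym e) (vertex-visits W j)))
  simple-injective (step _ W) (¬v , s) {suc i} {zero}  e =
    ⊥-elim (¬v (subst (λ z → Visits z W) e (vertex-visits W i)))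
  simple-injective (step _ W) (_ , s)  {suc i} {suc j} e = cong suc (simple-injective W s e)

record Exit {t} (E : Fin t → Fin t → Bool) (Q : Fin t → Bool) (v y : Fin t) (ℓ : ℕ) : Set where
  field
    p q    : Fin t
    ℓ₁ ℓ₂  : ℕ
    p-in   : Q p ≡ true
    q-out  : Q q ≡ false
    edge   : E p q ≡ true
    to-p   : Walk E v p ℓ₁
    from-q : Walk E q y ℓ₂
    length : ℓ₁ + suc ℓ₂ ≡ ℓ

exit : ∀ {t} {E : Fin t → Fin t → Bool} (Q : Fin t → Bool) {v y ℓ} →
  Walk E v y ℓ → Q v ≡ true → Q y ≡ false → Exit E Q v y ℓ
exit Q here qv qy = ⊥-elim (true≢false (trans (sym qv) qy))
exit Q (step {x} {z} e W) qv qy with Q z in qz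
... | false = record { p = x ; q = z ; ℓ₁ = 0 ; ℓ₂ = _ ; p-in = qv ; q-out = qz ; edge = e
                     ; to-p = here ; from-q = W ; length = refl }
... | true  = record { p = p ; q = q ; ℓ₁ = suc ℓ₁ ; ℓ₂ = ℓ₂ ; p-in = p-in ; q-out = q-out ; edge = edge
                     ; to-p = step e to-p ; from-q = from-q ; length = cong suc length }
  where open Exit (exit Q W qz qy)

SameEdge : ∀ {t} → Fin t → Fin t → Fin t → Fin t → Set
SameEdge u w a b = (a ≡ u × b ≡ w) ⊎ (a ≡ w × b ≡ u)

sameEdge? : ∀ {t} (u w a b : Fin t) → Dec (SameEdge u w a b)
sameEdge? u w a b = ((a ≟ u) ×-dec (b ≟ w)) ⊎-dec ((a ≟ w) ×-dec (b ≟ u))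

removeEdge-spec : ∀ {t} (T : Graph t) u w a b →
  removeEdge T u w a b ≡ adj T a b ∧ not (does (sameEdge? u w a b))
removeEdge-spec T u w a b
  rewrite isYes≗does (a ≟ u) | isYes≗does (b ≟ w) | isYes≗does (a ≟ w) | isYes≗does (b ≟ u) = refl

removeEdge-sub : ∀ {t} (T : Graph t) u w a b → removeEdge T u w a b ≡ true → adj T a b ≡ true
removeEdge-sub T u w a b e rewrite removeEdge-spec T u w a b = ∧-conicalˡ _ _ e

removeEdge-kept : ∀ {t} (T : Graph t) u w a b → adj T a b ≡ true → ¬ SameEdge u w a b →
  removeEdge T u w a b ≡ true
removeEdge-kept T u w a b ab ¬uw
  rewrite removeEdge-spec T u w a b | ab | dec-false (sameEdge? u w a b) ¬uw = refl

removeEdge-removed : ∀ {t} (T : Graph t) u w a b → SameEdge u w a b → removeEdge T u w a b ≡ false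
removeEdge-removed T u w a b uw
  rewrite removeEdge-spec T u w a b | dec-true (sameEdge? u w a b) uw = ∧-zeroʳ _

removeEdge-lost : ∀ {t} (T : Graph t) u w a b → adj T a b ≡ true → removeEdge T u w a b ≡ false →
  SameEdge u w a b
removeEdge-lost T u w a b ab gone with sameEdge? u w a b
... | yes uw = uw
... | no ¬uw = ⊥-elim (true≢false (trans (sym (removeEdge-kept T u w a b ab ¬uw)) gone))

removeEdge-swap : ∀ {t} (T : Graph t) u w a b → removeEdge T u w a b ≡ removeEdge T w u a b
removeEdge-swap T u w a b rewrite removeEdge-spec T u w a b | removeEdge-spec T w u a b =
  cong (λ z → adj T a b ∧ not z) (does-⇔ (mk⇔ Sum.swap Sum.swap) (sameEdge? u w a b) (sameEdge? w u a b))

removeEdge-sym : ∀ {t} (T : Graph t) u w a b → removeEdge T u w a b ≡ removeEdge T u w b a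
removeEdge-sym T u w a b rewrite removeEdge-spec T u w a b | removeEdge-spec T u w b a =
  cong₂ (λ x z → x ∧ not z) (Graph.sym T a b)
    (does-⇔ (mk⇔ flip flip) (sameEdge? u w a b) (sameEdge? u w b a))
  where
  flip : ∀ {a b} → SameEdge u w a b → SameEdge u w b a
  flip = Sum.swap ∘ Sum.map Product.swap Product.swap

module TreeSides (TT : TernaryTree) where

  N : ℕ
  N = size TT

  Tg : Graph N
  Tg = tree TT

  Side : Fin N → Fin N → Fin N → Set
  Side u w z = Reach (removeEdge Tg u w) u z

  adj-sym : ∀ {a b} → adj Tg a b ≡ true → adj Tg b a ≡ true
  adj-sym {a} {b} e = trans (Graph.sym Tg b a) e

  adj-irreflexive : ∀ {a b} → adj Tg a b ≡ true → a ≢ b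
  adj-irreflexive {a} e refl = true≢false (trans (sym e) (irrefl Tg a))

  -- Acyclicity: once the edge uw is deleted, w no longer reaches u, since a
  -- simple such walk together with uw would form a cycle of T.
  no-return : ∀ {u w} → adj Tg u w ≡ true → ¬ Reach (removeEdge Tg u w) w u
  no-return {u} {w} uw (_ , W) with shortcut W
  ... | 0 , here , _ = adj-irreflexive uw refl
  ... | 1 , step e here , _ =
    true≢false (trans (sym e) (removeEdge-removed Tg u w w u (inj₂ (refl , refl))))
  ... | suc (suc j) , W′ , simple =
    acyclic TT j (vertex W′) (simple-injective W′ simple , in-T , closing)
    where
    in-T : ∀ i → adj Tg (vertex W′ (inject₁ i)) (vertex W′ (suc i)) ≡ true
    in-T i = removeEdge-sub Tg u w _ _ (vertex-adj W′ i)
    closing : adj Tg (vertex W′ (fromℕ (2 + j))) (vertex W′ zero) ≡ true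
    closing = subst (λ z → adj Tg z w ≡ true) (sym (vertex-last W′)) uw

  sides-disjoint : ∀ {u w z} → adj Tg u w ≡ true → Side u w z → Side w u z → ⊥
  sides-disjoint {u} {w} uw (_ , from-u) (_ , from-w) =
    no-return uw (_ , append (walk-map swap from-w) (reverse (removeEdge-sym Tg u w) from-u))
    where
    swap : ∀ a b → removeEdge Tg w u a b ≡ true → removeEdge Tg u w a b ≡ true
    swap a b e = trans (removeEdge-swap Tg u w a b) e

  -- ... and every vertex lies on one of them: follow a walk of T from u,
  -- switching sides exactly when crossing uw.
  sides-cover : ∀ {u w} → adj Tg u w ≡ true → ∀ z → Side u w z ⊎ Side w u z
  sides-cover {u} {w} uw z = follow (inj₁ (0 , here)) (proj₂ (connected TT u z))
    where
    follow : ∀ {a z ℓ} → Side u w a ⊎ Side w u a → Walk (adj Tg) a z ℓ → Side u w z ⊎ Side w u z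
    follow s here = s
    follow {a} s (step {y = b} e W) with removeEdge Tg u w a b in kept
    ... | true = follow (extend s) W
      where
      extend : Side u w a ⊎ Side w u a → Side u w b ⊎ Side w u b
      extend (inj₁ r) = inj₁ (reach-snoc r kept)
      extend (inj₂ r) = inj₂ (reach-snoc r (trans (sym (removeEdge-swap Tg u w a b)) kept))
    ... | false with removeEdge-lost Tg u w a b e kept
    ...   | inj₁ (refl , refl) = follow (inj₂ (0 , here)) W
    ...   | inj₂ (refl , refl) = follow (inj₁ (0 , here)) W

  side-excludes : ∀ {x u a} → adj Tg x u ≡ true → Side x u a → a ≢ u
  side-excludes xu s refl = sides-disjoint xu s (0 , here)

  first-step : ∀ {u w z} → adj Tg u w ≡ true → Side u w z → z ≢ u →
    ∃[ v ] (adj Tg u v ≡ true × v ≢ w × Side v u z)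
  first-step {u} {w} uw (_ , W) z≢u with follow (inj₁ refl) W
    where
    Behind : Fin N → Set
    Behind a = a ≡ u ⊎ ∃[ v ] (adj Tg u v ≡ true × v ≢ w × Side v u a)
    follow : ∀ {a z ℓ} → Behind a → Walk (removeEdge Tg u w) a z ℓ → Behind z
    follow st here = st
    follow {a} st (step {y = b} e W) = follow (next (b ≟ u) st) W
      where
      next : Dec (b ≡ u) → Behind a → Behind b
      next (yes b≡u) _ = inj₁ b≡u
      next (no b≢u) (inj₁ refl) =
        inj₂ (b , removeEdge-sub Tg u w u b e , b≢w , (0 , here))
        where
        b≢w : b ≢ w
        b≢w refl = true≢false (trans (sym e) (removeEdge-removed Tg u w u w (inj₁ (refl , refl))))
      next (no b≢u) (inj₂ (v , uv , v≢w , sv)) =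
        inj₂ (v , uv , v≢w , reach-snoc sv kept)
        where
        kept : removeEdge Tg v u a b ≡ true
        kept = removeEdge-kept Tg v u a b (removeEdge-sub Tg u w a b e)
                 λ { (inj₁ (_ , b≡u)) → b≢u b≡u ; (inj₂ (a≡u , _)) → side-excludes (adj-sym uv) sv a≡u }
  ... | inj₁ z≡u = ⊥-elim (z≢u z≡u)
  ... | inj₂ r   = r

  nested-side : ∀ {u w x z} → adj Tg u w ≡ true → adj Tg u x ≡ true → x ≢ w →
    Side x u z → Side u w z
  nested-side {u} {w} {x} uw ux x≢w (_ , W) = _ , step first (transfer (0 , here) W)
    where
    first : removeEdge Tg u w u x ≡ true
    first = removeEdge-kept Tg u w u x ux
              λ { (inj₁ (_ , x≡w)) → x≢w x≡w ; (inj₂ (u≡w , _)) → adj-irreflexive uw u≡w }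
    transfer : ∀ {a z ℓ} → Side x u a → Walk (removeEdge Tg x u) a z ℓ → Walk (removeEdge Tg u w) a z ℓ
    transfer sa here = here
    transfer {a} sa (step {y = b} e W) = step kept (transfer sb W)
      where
      sb : Side x u b
      sb = reach-snoc sa e
      kept : removeEdge Tg u w a b ≡ true
      kept = removeEdge-kept Tg u w a b (removeEdge-sub Tg x u a b e)
               λ { (inj₁ (a≡u , _)) → side-excludes (adj-sym ux) sa a≡u
                 ; (inj₂ (_ , b≡u)) → side-excludes (adj-sym ux) sb b≡u }

  unique-neighbour : ∀ {u w} → deg Tg u ≡ 1 → adj Tg u w ≡ true → ∀ v → adj Tg u v ≡ true → v ≡ w
  unique-neighbour {u} {w} d uw v uv with member-split (adj Tg u) uv
  ... | inj₁ v≡w = v≡w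
  ... | inj₂ e   = ⊥-elim (true≢false (trans (sym e) (count-zero none v)))
    where
    none : count (adj Tg u without w) ≡ 0
    none = suc-injective (trans (sym (count-remove w uw)) d)

  record Branches (u w : Fin N) : Set where
    field
      x y : Fin N
      ux  : adj Tg u x ≡ true
      uy  : adj Tg u y ≡ true
      x≢w : x ≢ w
      y≢w : y ≢ w
      all : ∀ v → adj Tg u v ≡ true → v ≡ w ⊎ v ≡ x ⊎ v ≡ y

  branches : ∀ {u w} → deg Tg u ≡ 3 → adj Tg u w ≡ true → Branches u w
  branches {u} {w} d uw with count-pick (adj Tg u without w) (suc-injective (trans (sym (count-remove w uw)) d))
  ... | x , x-in , one with count-pick (adj Tg u without w without x) one
  ... | y , y-in , none = record
    { x = x ; y = y ; ux = proj₁ x-fact ; uy = proj₁ y-fact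
    ; x≢w = proj₂ x-fact ; y≢w = proj₂ y-fact ; all = all }
    where
    x-fact : adj Tg u x ≡ true × x ≢ w
    x-fact = without-elim (adj Tg u) x-in
    y-fact : adj Tg u y ≡ true × y ≢ w
    y-fact = without-elim (adj Tg u) (proj₁ (without-elim (adj Tg u without w) y-in))
    all : ∀ v → adj Tg u v ≡ true → v ≡ w ⊎ v ≡ x ⊎ v ≡ y
    all v uv with member-split (adj Tg u) uv
    ... | inj₁ v≡w = inj₁ v≡w
    ... | inj₂ e₁ with member-split (adj Tg u without w) e₁
    ...   | inj₁ v≡x = inj₂ (inj₁ v≡x)
    ...   | inj₂ e₂ with member-split (adj Tg u without w without x) e₂
    ...     | inj₁ v≡y = inj₂ (inj₂ v≡y)
    ...     | inj₂ e₃ = ⊥-elim (true≢false (trans (sym e₃) (count-zero none v)))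

  ¬¬-sides-decidable : ¬ ¬ (∀ u w z → Dec (Side u w z))
  ¬¬-sides-decidable =
    ¬¬-finite-choice λ u → ¬¬-finite-choice λ w → ¬¬-decide-all (Side u w)

bit : Bool → Fin 2
bit false = zero
bit true  = suc zero

bit-injective : ∀ {x y} → bit x ≡ bit y → x ≡ y
bit-injective {false} {false} _ = refl
bit-injective {true}  {true}  _ = refl

encode : ∀ {j} → (Fin j → Bool) → Fin (2 ^ j)
encode c = funToFin (bit ∘ c)

encode-injective : ∀ {j} (c c′ : Fin j → Bool) → encode c ≡ encode c′ → ∀ i → c i ≡ c′ i
encode-injective c c′ e i = bit-injective (begin
  bit (c i)               ≡⟨ finToFun-funToFin (bit ∘ c) i ⟨
  finToFun (encode c) i   ≡⟨ cong (λ z → finToFun z i) e ⟩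
  finToFun (encode c′) i  ≡⟨ finToFun-funToFin (bit ∘ c′) i ⟩
  bit (c′ i)              ∎)
  where open ≡-Reasoning

⊕-sum-cong : ∀ {j} {b b′ : Fin j → Bool} → (∀ i → b i ≡ b′ i) → ⊕-sum b ≡ ⊕-sum b′
⊕-sum-cong {zero}  h = refl
⊕-sum-cong {suc j} h = cong₂ _xor_ (h zero) (⊕-sum-cong (λ i → h (suc i)))

⊕-sum-zero : ∀ {j} {b : Fin j → Bool} → (∀ i → b i ≡ false) → ⊕-sum b ≡ false
⊕-sum-zero {zero}  h = refl
⊕-sum-zero {suc j} h rewrite h zero = ⊕-sum-zero (λ i → h (suc i))

xor-zero : ∀ x y → x xor y ≡ false → y ≡ x
xor-zero false false _ = refl
xor-zero true  true  _ = refl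

module Independence {m K : ℕ} (vec : Fin K → Fin m → Bool)
  (distinct : ∀ i i′ → i ≢ i′ → ¬ (∀ t → vec i t ≡ vec i′ t)) where

  combination : ∀ {j} → (Fin j → Bool) → (Fin j → Fin K) → Fin m → Bool
  combination c sel t = ⊕-sum (λ i → c i ∧ vec (sel i) t)

  Independent : ∀ {j} → (Fin j → Fin K) → Set
  Independent {j} sel =
    ∀ (c : Fin j → Bool) → (∃[ i ] c i ≡ true) → ∃[ t ] combination c sel t ≡ true

  InSpan : ∀ {j} → (Fin j → Fin K) → Fin K → Set
  InSpan {j} sel i₀ = Σ (Fin j → Bool) λ c → ∀ t → combination c sel t ≡ vec i₀ t

  -- j vectors span at most 2^j vectors, so for K > 2^j some vec i₀ lies
  -- outside the span (classically: we cannot decide which one).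
  outside-span : ∀ {j} → 2 ^ j < K → (sel : Fin j → Fin K) → ¬ ¬ (∃[ i₀ ] ¬ InSpan sel i₀)
  outside-span {j} 2^j<K sel found =
    ¬¬-finite-choice (λ i₀ ¬span → found (i₀ , ¬span)) all-in-span
    where
    all-in-span : ¬ (∀ i₀ → InSpan sel i₀)
    all-in-span span = <⇒notInjective 2^j<K code-injective
      where
      code : Fin K → Fin (2 ^ j)
      code i₀ = encode (proj₁ (span i₀))
      code-injective : Injective _≡_ _≡_ code
      code-injective {i} {i′} e with i ≟ i′
      ... | yes i≡i′ = i≡i′
      ... | no  i≢i′ = ⊥-elim (distinct i i′ i≢i′ λ t → begin
        vec i t                                ≡⟨ proj₂ (span i) t ⟨
        combination (proj₁ (span i)) sel t
          ≡⟨ ⊕-sum-cong (λ l → cong (_∧ vec (sel l) t) (encode-injective _ _ e l)) ⟩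
        combination (proj₁ (span i′)) sel t    ≡⟨ proj₂ (span i′) t ⟩
        vec i′ t                               ∎)
        where open ≡-Reasoning

  extend : ∀ {j} (sel : Fin j → Fin K) → Independent sel → ∀ i₀ → ¬ InSpan sel i₀ →
    Σ (Fin (suc j) → Fin K) Independent
  extend {j} sel ind i₀ ¬span = sel′ , ind′
    where
    sel′ : Fin (suc j) → Fin K
    sel′ zero    = i₀
    sel′ (suc i) = sel i
    ind′ : Independent sel′
    ind′ c (i , ci) with c zero in c₀
    ind′ c (zero  , ci) | false = ⊥-elim (true≢false (trans (sym ci) c₀))
    ind′ c (suc i , ci) | false = ind (c ∘ suc) (i , ci)
    ind′ c (i     , ci) | true
      with any? (λ t → vec i₀ t xor combination (c ∘ suc) sel t ≟ᵇ true)
    ... | yes nonzero = nonzero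
    ... | no  zero-everywhere = ⊥-elim (¬span (c ∘ suc , λ t →
            xor-zero (vec i₀ t) _ (¬true (λ e → zero-everywhere (t , e)))))
      where
      ¬true : ∀ {b} → b ≢ true → b ≡ false
      ¬true {false} _ = refl
      ¬true {true}  h = ⊥-elim (h refl)

  independent-subfamily : ∀ {k} → 2 ^ k < K → ¬ ¬ Σ (Fin (suc k) → Fin K) Independent
  independent-subfamily {k} 2^k<K = grow (suc k) ≤-refl
    where
    grow : ∀ j → j ≤ suc k → ¬ ¬ Σ (Fin j → Fin K) Independent
    grow zero    _         found = found ((λ ()) , λ c → λ { (() , _) })
    grow (suc j) (s≤s j≤k) found =
      grow j (m≤n⇒m≤1+n j≤k) λ { (sel , ind) →
        outside-span (≤-<-trans (^-monoʳ-≤ 2 j≤k) 2^k<K) sel λ { (i₀ , ¬span) →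
          found (extend sel ind i₀ ¬span) } }

record SeparatingBalls {m} (H : Graph m) (Q : Fin m → Bool) (K : ℕ) : Set where
  field
    centre     : Fin K → Fin m
    radius     : Fin K → ℕ
    target     : Fin K → Fin m
    centre-in  : ∀ i → Q (centre i) ≡ true
    target-out : ∀ i → Q (target i) ≡ false
    reaches    : ∀ i → InBall H (centre i) (radius i) (target i)
    separates  : ∀ i j → i ≢ j → ¬ InBall H (centre i) (radius i) (target j)

module CutCrossing {n m : ℕ} (G : Graph n) (g : Fin m → Fin n) (k : ℕ)
  (Rows : Fin n → Set) (rank : CutRankLe G Rows k) (Q : Fin m → Bool)
  (rows : ∀ x → Q x ≡ false → Rows (g x)) (cols : ∀ x → Q x ≡ true → ¬ Rows (g x)) where

  H : Graph m
  H = induced G g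

  module Crossing {K : ℕ} (B : SeparatingBalls H Q K) where
    open SeparatingBalls B

    leave : ∀ i → Exit (adj H) Q (centre i) (target i) (proj₁ (reaches i))
    leave i = exit Q (proj₂ (proj₂ (reaches i))) (centre-in i) (target-out i)

    door : Fin K → Fin m
    door i = Exit.q (leave i)

    -- the neighbourhood of door i inside Q: its row in the cut matrix
    trace : Fin K → Fin m → Bool
    trace i x = Q x ∧ adj H (door i) x

    -- If door j has the trace of door i and is no farther from target j than
    -- door i is from target i, then centre i → p → door j → target j
    -- stays within ball i.
    same-trace-reaches : ∀ i j → (∀ x → trace i x ≡ trace j x) →
      Exit.ℓ₂ (leave j) ≤ Exit.ℓ₂ (leave i) → InBall H (centre i) (radius i) (target j)
    same-trace-reaches i j same closer =
      _ , within , append (Exit.to-p (leave i)) (step p~door (Exit.from-q (leave j)))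
      where
      open Exit (leave i) using (p; p-in; edge; ℓ₁; length)
      p∈trace-i : trace i p ≡ true
      p∈trace-i = subst (λ z → z ∧ adj H (door i) p ≡ true) (sym p-in)
                    (trans (Graph.sym H (door i) p) edge)
      p~door : adj H p (door j) ≡ true
      p~door = trans (Graph.sym H p (door j)) (∧-conicalʳ _ _ (trans (sym (same p)) p∈trace-i))
      within : ℓ₁ + suc (Exit.ℓ₂ (leave j)) ≤ radius i
      within = ≤-trans (+-monoʳ-≤ ℓ₁ (s≤s closer))
                 (subst (_≤ radius i) (sym length) (proj₁ (proj₂ (reaches i))))

    traces-distinct : ∀ i j → i ≢ j → ¬ (∀ x → trace i x ≡ trace j x)
    traces-distinct i j i≢j same with ≤-total (Exit.ℓ₂ (leave j)) (Exit.ℓ₂ (leave i))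
    ... | inj₁ j-closer = separates i j i≢j (same-trace-reaches i j same j-closer)
    ... | inj₂ i-closer =
      separates j i (i≢j ∘ sym) (same-trace-reaches j i (λ x → sym (same x)) i-closer)

    open Independence trace traces-distinct public

    independent-rows : (sel : Fin (suc k) → Fin K) → Independent sel →
      RowsIndependent G Rows (λ i → g (door (sel i)))
    independent-rows sel ind c nonzero with ind c nonzero
    ... | x , e with Q x in Qx
    ...   | true  = g x , cols x Qx , e
    ...   | false = ⊥-elim (true≢false (trans (sym e) (⊕-sum-zero (λ i → ∧-zeroʳ (c i)))))

  no-separating-balls : ∀ {K} → 2 ^ k < K → ¬ SeparatingBalls H Q K
  no-separating-balls 2^k<K B = independent-subfamily 2^k<K λ (sel , ind) →
    rank _ (λ i → rows _ (Exit.q-out (leave (sel i)))) (independent-rows sel ind)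
    where open Crossing B

sum-of-three-below : ∀ {a b c K} → a < K → b < K → c < K → a + b + c < 3 * K
sum-of-three-below {a} {b} {c} {K} a<K b<K c<K =
  subst (a + b + c <_) 3K (+-mono-< (+-mono-< a<K b<K) c<K)
  where
  3K : K + K + K ≡ 3 * K
  3K = trans (+-assoc K K K) (cong (λ z → K + (K + z)) (sym (+-identityʳ K)))

module Descent {n : ℕ} (G : Graph n) (k : ℕ) (R : TreeRep n) (width : RepWidthLe G R k)
  {m : ℕ} (g : Fin m → Fin n) (g-inj : Injective _≡_ _≡_ g)
  (X : Subset m) (shattered : TwoShatteredB (induced G g) X)
  (side? : ∀ u w z → Dec (TreeSides.Side (T R) u w z))
  (large : 3 * suc (2 ^ k) ≤ count (lookup X)) where

  open TreeSides (T R)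

  K : ℕ
  K = suc (2 ^ k)

  H : Graph m
  H = induced G g

  inX : Fin m → Bool
  inX = lookup X

  leaf : Fin m → Fin N
  leaf i = f R (g i)

  leaf-injective : Injective _≡_ _≡_ leaf
  leaf-injective e = g-inj (f-inj R e)

  onSide : Fin N → Fin N → Fin N → Bool
  onSide u w z = does (side? u w z)

  L : Fin N → Fin N → ℕ
  L u w = count (λ i → inX i ∧ onSide u w (leaf i))

  nodes : Fin N → Fin N → ℕ
  nodes u w = count (onSide u w)

  on-one-side : ∀ {u w z} → adj Tg u w ≡ true → onSide u w z ≡ true → onSide w u z ≡ false
  on-one-side {u} {w} {z} uw s =
    dec-false (side? w u z) (sides-disjoint uw (does-true (side? u w z) s))

  on-some-side : ∀ {u w z} → adj Tg u w ≡ true → onSide w u z ≢ true → onSide u w z ≡ true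
  on-some-side {u} {w} {z} uw ¬s with sides-cover uw z
  ... | inj₁ s = dec-true (side? u w z) s
  ... | inj₂ s = ⊥-elim (¬s (dec-true (side? w u z) s))

  complement : ∀ {u w} → adj Tg u w ≡ true → ∀ z → not (onSide u w z) ≡ onSide w u z
  complement {u} {w} uw z with onSide u w z in s
  ... | true  = sym (on-one-side uw s)
  ... | false with onSide w u z in s′
  ...   | true  = refl
  ...   | false = ⊥-elim (true≢false (trans (sym (on-some-side uw (λ e → true≢false (trans (sym e) s′)))) s))

  L-total : ∀ {u w} → adj Tg u w ≡ true → L u w + L w u ≡ count inX
  L-total {u} {w} uw =
    trans (cong (L u w +_) (count-cong (λ i → cong (inX i ∧_) (sym (complement uw (leaf i))))))
          (count-split inX (λ i → onSide u w (leaf i)))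

  member : ∀ {i} → inX i ≡ true → i ∈ X
  member {i} e = lookup⇒[]= i X e

  crossing-balls : ∀ {x y K′} → adj Tg x y ≡ true → 2 ^ k < K′ →
    ¬ SeparatingBalls H (onSide y x ∘ leaf) K′
  crossing-balls {x} {y} xy =
    CutCrossing.no-separating-balls G g k (EdgeSide R x y) (width x y xy) (onSide y x ∘ leaf) rows cols
    where
    rows : ∀ q → onSide y x (leaf q) ≡ false → EdgeSide R x y (g q)
    rows q off = does-true (side? x y (leaf q)) (on-some-side xy (λ on → true≢false (trans (sym on) off)))
    cols : ∀ q → onSide y x (leaf q) ≡ true → ¬ EdgeSide R x y (g q)
    cols q on s = sides-disjoint xy s (does-true (side? y x (leaf q)) on)

  -- No edge uw has K elements of X on both sides: choose such a_i on u's
  -- side and b_j on w's side, and balls B_ij with B_ij ∩ X = {a_i, b_j}.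
  -- Either some column j has all its centres on w's side, and its balls
  -- separate the a_i across uw, or every column j has a centre on u's side,
  -- and these balls separate the b_j across wu.
  module BalancedEdge {u w} (uw : adj Tg u w ≡ true) (heavy-u : K ≤ L u w) (heavy-w : K ≤ L w u) where

    selection-u : Selection (λ i → inX i ∧ onSide u w (leaf i)) K
    selection-u = count-select _ K heavy-u

    selection-w : Selection (λ i → inX i ∧ onSide w u (leaf i)) K
    selection-w = count-select _ K heavy-w

    a b : Fin K → Fin m
    a = Selection.pick selection-u
    b = Selection.pick selection-w

    a-in : ∀ i → inX (a i) ≡ true × onSide u w (leaf (a i)) ≡ true
    a-in i = ∧-conicalˡ _ _ (Selection.chosen selection-u i) , ∧-conicalʳ _ _ (Selection.chosen selection-u i)

    b-in : ∀ j → inX (b j) ≡ true × onSide w u (leaf (b j)) ≡ true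
    b-in j = ∧-conicalˡ _ _ (Selection.chosen selection-w j) , ∧-conicalʳ _ _ (Selection.chosen selection-w j)

    a≢b : ∀ i j → a i ≢ b j
    a≢b i j e = true≢false (trans (sym (proj₂ (a-in i)))
                  (trans (cong (onSide u w ∘ leaf) e) (on-one-side (adj-sym uw) (proj₂ (b-in j)))))

    ball : ∀ i j → ∃[ v ] ∃[ r ] (InBall H v r (a i) × InBall H v r (b j) ×
                     (∀ x → x ∈ X → InBall H v r x → x ≡ a i ⊎ x ≡ b j))
    ball i j = shattered (a i) (b j) (member (proj₁ (a-in i))) (member (proj₁ (b-in j))) (a≢b i j)

    centre : Fin K → Fin K → Fin m
    centre i j = proj₁ (ball i j)

    radius : Fin K → Fin K → ℕ
    radius i j = proj₁ (proj₂ (ball i j))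

    only-ends : ∀ i j x → x ∈ X → InBall H (centre i j) (radius i j) x → x ≡ a i ⊎ x ≡ b j
    only-ends i j = proj₂ (proj₂ (proj₂ (proj₂ (ball i j))))

    column-across : ∀ j → (∀ i → onSide w u (leaf (centre i j)) ≡ true) → ⊥
    column-across j across = crossing-balls uw ≤-refl record
      { centre = λ i → centre i j ; radius = λ i → radius i j ; target = a
      ; centre-in = across
      ; target-out = λ i → on-one-side uw (proj₂ (a-in i))
      ; reaches = λ i → proj₁ (proj₂ (proj₂ (ball i j)))
      ; separates = separates }
      where
      separates : ∀ i i′ → i ≢ i′ → ¬ InBall H (centre i j) (radius i j) (a i′)
      separates i i′ i≢i′ hit with only-ends i j (a i′) (member (proj₁ (a-in i′))) hit
      ... | inj₁ same = i≢i′ (sym (Selection.injective selection-u same))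
      ... | inj₂ same = a≢b i′ j same

    rows-across : (∀ j → ∃[ i ] onSide u w (leaf (centre i j)) ≡ true) → ⊥
    rows-across across = crossing-balls (adj-sym uw) ≤-refl record
      { centre = λ j → centre (row j) j ; radius = λ j → radius (row j) j ; target = b
      ; centre-in = λ j → proj₂ (across j)
      ; target-out = λ j → on-one-side (adj-sym uw) (proj₂ (b-in j))
      ; reaches = λ j → proj₁ (proj₂ (proj₂ (proj₂ (ball (row j) j))))
      ; separates = separates }
      where
      row : Fin K → Fin K
      row j = proj₁ (across j)
      separates : ∀ j j′ → j ≢ j′ → ¬ InBall H (centre (row j) j) (radius (row j) j) (b j′)
      separates j j′ j≢j′ hit with only-ends (row j) j (b j′) (member (proj₁ (b-in j′))) hit
      ... | inj₁ same = a≢b (row j) j′ (sym same)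
      ... | inj₂ same = j≢j′ (sym (Selection.injective selection-w same))

    impossible : ⊥
    impossible = ¬¬-excluded-middle {A = ∃[ j ] ∀ i → onSide w u (leaf (centre i j)) ≡ true} λ
      { (yes (j , across)) → column-across j across
      ; (no ¬column) → ¬¬-finite-choice (λ j not-across → ¬column (j , λ i →
          on-some-side (adj-sym uw) λ on → not-across (i , on))) rows-across }

  own-side : ∀ u w → onSide u w u ≡ true
  own-side u w = dec-true (side? u w u) (0 , here)

  -- The side of a leaf u holds at most one element of X: the side is {u}.
  leaf-side-small : ∀ {u w} → deg Tg u ≡ 1 → adj Tg u w ≡ true → L u w ≤ 1
  leaf-side-small {u} {w} d uw = count-≤1 λ i j ei ej →
    leaf-injective (trans (only-u (∧-conicalʳ _ _ ei)) (sym (only-u (∧-conicalʳ _ _ ej))))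
    where
    only-u : ∀ {z} → onSide u w z ≡ true → z ≡ u
    only-u {z} s with z ≟ u
    ... | yes z≡u = z≡u
    ... | no  z≢u with first-step uw (does-true (side? u w z) s) z≢u
    ...   | v , uv , v≢w , _ = ⊥-elim (v≢w (unique-neighbour d uw v uv))

  branch-split : ∀ {u w} → deg Tg u ≡ 3 → adj Tg u w ≡ true → (br : Branches u w) →
    L u w ≤ L (Branches.x br) u + L (Branches.y br) u
  branch-split {u} {w} d uw br = count-union λ i e →
    behind i (∧-conicalˡ _ _ e) (first-step uw (does-true (side? u w (leaf i)) (∧-conicalʳ _ _ e)) (not-u i))
    where
    open Branches br
    not-u : ∀ i → leaf i ≢ u
    not-u i e with () ← trans (sym (f-leaf R (g i))) (trans (cong (deg Tg) e) d)
    behind : ∀ i → inX i ≡ true → ∃[ v ] (adj Tg u v ≡ true × v ≢ w × Side v u (leaf i)) →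
      inX i ∧ onSide x u (leaf i) ≡ true ⊎ inX i ∧ onSide y u (leaf i) ≡ true
    behind i xi (v , uv , v≢w , s) rewrite xi with all v uv
    ... | inj₁ v≡w        = ⊥-elim (v≢w v≡w)
    ... | inj₂ (inj₁ refl) = inj₁ (dec-true (side? v u (leaf i)) s)
    ... | inj₂ (inj₂ refl) = inj₂ (dec-true (side? v u (leaf i)) s)

  -- Stepping from uw to the edge xu, for a neighbour x ≠ w of u, strictly
  -- shrinks the side: it loses at least u.
  fewer-nodes : ∀ {u w x} → adj Tg u w ≡ true → adj Tg u x ≡ true → x ≢ w → nodes x u < nodes u w
  fewer-nodes {u} {w} {x} uw ux x≢w =
    count-strict inside u (dec-false (side? x u u) λ s → side-excludes (adj-sym ux) s refl) (own-side u w)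
    where
    inside : ∀ z → onSide x u z ≡ true → onSide u w z ≡ true
    inside z s = dec-true (side? u w z) (nested-side uw ux x≢w (does-true (side? x u z) s))

  -- No edge uw has K elements of X on u's side: otherwise walk away from w
  -- into a branch still holding K elements; at a leaf the side is too small,
  -- and when no branch qualifies, the three sides at u add up to less than
  -- 3K elements.
  descent : ∀ s {u w} → adj Tg u w ≡ true → nodes u w ≤ s → K ≤ L u w → ⊥
  descent zero {u} {w} uw few heavy = 1+n≰n (≤-trans (count-member u (own-side u w)) few)
  descent (suc s) {u} {w} uw few heavy with degree13 (T R) u
  ... | inj₁ d1 = <⇒≱ (s≤s (m^n>0 2 k)) (≤-trans heavy (leaf-side-small d1 uw))
  ... | inj₂ d3 = branch (K ≤? L x u) (K ≤? L y u)
    where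
    br : Branches u w
    br = branches d3 uw
    open Branches br
    light-w : L w u < K
    light-w = ≰⇒> (BalancedEdge.impossible uw heavy)
    recurse : ∀ {z} → adj Tg u z ≡ true → z ≢ w → K ≤ L z u → ⊥
    recurse uz z≢w = descent s (adj-sym uz) (≤-pred (≤-trans (fewer-nodes uw uz z≢w) few))
    covered : 3 * K ≤ L x u + L y u + L w u
    covered = begin
      3 * K              ≤⟨ large ⟩
      count inX          ≡⟨ L-total uw ⟨
      L u w + L w u      ≤⟨ +-monoˡ-≤ (L w u) (branch-split d3 uw br) ⟩
      L x u + L y u + L w u ∎
      where open ≤-Reasoning
    branch : Dec (K ≤ L x u) → Dec (K ≤ L y u) → ⊥
    branch (yes heavy-x) _             = recurse ux x≢w heavy-x
    branch _             (yes heavy-y) = recurse uy y≢w heavy-y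
    branch (no light-x)  (no light-y)  =
      <⇒≱ (sum-of-three-below (≰⇒> light-x) (≰⇒> light-y) light-w) covered

  heavy-side : ∀ {u w} → adj Tg u w ≡ true → K ≤ L u w ⊎ K ≤ L w u
  heavy-side {u} {w} uw with K ≤? L u w | K ≤? L w u
  ... | yes heavy | _         = inj₁ heavy
  ... | no _      | yes heavy = inj₂ heavy
  ... | no light-u | no light-w =
    ⊥-elim (<⇒≱ (sum-of-three-below (≰⇒> light-u) (≰⇒> light-w) (s≤s z≤n))
                (≤-trans large (≤-reflexive (sym (trans (+-identityʳ _) (L-total uw))))))

  -- The tree has an edge (at the leaf of any element of X), and descending
  -- from its heavy side is impossible.
  impossible : ⊥
  impossible with count-witness (≤-trans (s≤s z≤n) large)
  ... | i , _ with count-witness {b = adj Tg (leaf i)} (≤-reflexive (sym (f-leaf R (g i))))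
  ... | w , uw with heavy-side uw
  ...   | inj₁ heavy = descent _ uw ≤-refl heavy
  ...   | inj₂ heavy = descent _ (adj-sym uw) ≤-refl heavy

bound : ∀ k → 3 * suc (2 ^ k) ≤ suc (3 * 2 ^ (k + 1) + 2)
bound k = begin
  3 * suc x            ≡⟨ *-suc 3 x ⟩
  3 + 3 * x            ≤⟨ +-monoʳ-≤ 3 (*-monoʳ-≤ 3 (m≤m+n x (x + 0))) ⟩
  3 + 3 * (2 * x)      ≡⟨ +-comm 3 (3 * (2 * x)) ⟩
  3 * (2 * x) + 3      ≡⟨ cong (λ z → 3 * 2 ^ z + 3) (+-comm 1 k) ⟩
  3 * 2 ^ (k + 1) + 3  ≡⟨ +-suc (3 * 2 ^ (k + 1)) 2 ⟩
  suc (3 * 2 ^ (k + 1) + 2) ∎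
  where
  x = 2 ^ k
  open ≤-Reasoning

theorem7 : ∀ (n : ℕ) (G : Graph n) (k : ℕ) → HasRankwidth G k →
    Distance2VCDimLe G (3 * 2 ^ (k + 1) + 2)
theorem7 n G k ((R , width) , _) m g g-inj X shattered =
  decidable-stable (∣ X ∣ ≤? 3 * 2 ^ (k + 1) + 2) λ too-large →
    TreeSides.¬¬-sides-decidable (T R) λ side? →
      Descent.impossible G k R width g g-inj X shattered side? (large too-large)
  where
  large : ¬ ∣ X ∣ ≤ 3 * 2 ^ (k + 1) + 2 → 3 * suc (2 ^ k) ≤ count (lookup X)
  large too-large = ≤-trans (bound k) (subst (_ ≤_) (∣∣≡count X) (≰⇒> too-large))
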